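{- Let $a,b$ be integers with $\{|a|,|b|\}=\{0,1\}$, and let $\mathcal{T}=\{(0\,|\,0,a),(0\,|\,0,b)\}$. Then $\bigl|\mathcal{C}_{(0|0,a)}\cap\mathcal{C}_{(0|0,b)}\bigr|=1$.
   Context: A partition is a weakly decreasing sequence of non-negative integers with finite sum; a bipartition is a pair $(\lambda,\mu)$ of partitions, with nodes $(a,b,1)$ for $b\le\lambda_a$ and $(a,b,2)$ for $b\le\mu_a$. For $c=(c_1,c_2)\in\mathbb{Z}^2$ the $(0\,|\,c)$-residue of a node $(a,b,k)$ is the integer $b-a+c_k$, and the $(0\,|\,c)$-content of a bipartition is the multiset of residues of its nodes. A bipartition is a $(0\,|\,c)$-core if no other bipartition has the same $(0\,|\,c)$-content; $\mathcal{C}_{(0|c_1,c_2)}$ is the set of such cores. -}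

module Defs where

open import Data.Nat using (ℕ; zero; suc; _<_; _≥_)
open import Data.Integer using (ℤ; +_; _+_; _-_)
open import Data.List using (List; []; _∷_; _++_; map; upTo)
open import Data.List.Relation.Unary.All using (All)
open import Data.List.Relation.Unary.Linked using (Linked)
open import Data.List.Relation.Binary.Permutation.Propositional using (_↭_)
open import Data.Product using (_×_; _,_)
open import Relation.Binary.PropositionalEquality using (_≡_)

-- A partition is represented by its list of nonzero parts, weakly decreasing
-- (trailing zeros dropped, so representation is canonical).
IsPartition : List ℕ → Set
IsPartition l = All (0 <_) l × Linked _≥_ l

Bipartition : Set
Bipartition = List ℕ × List ℕ

IsBipartition : Bipartition → Set
IsBipartition (l , m) = IsPartition l × IsPartition m

Charge : Set
Charge = ℤ × ℤ

-- residues of the nodes (a, b) with 1 ≤ b ≤ len in row a: b - a + c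
rowResidues : ℤ → ℕ → ℕ → List ℤ
rowResidues c a len = map (λ j → ((+ suc j) - (+ a)) + c) (upTo len)

partResidues : ℤ → ℕ → List ℕ → List ℤ
partResidues c a [] = []
partResidues c a (l ∷ ls) = rowResidues c a l ++ partResidues c (suc a) ls

-- the (0 | c)-content, as a list of residues (a multiset up to permutation)
content : Charge → Bipartition → List ℤ
content (c₁ , c₂) (l , m) = partResidues c₁ 1 l ++ partResidues c₂ 1 m

IsCore : Charge → Bipartition → Set
IsCore c bp = IsBipartition bp ×
  ((bp' : Bipartition) → IsBipartition bp' → content c bp' ↭ content c bp → bp' ≡ bp)

-- For charge (0 | 0, 0) swapping the two components preserves content, so a core (λ, μ)
-- has λ = μ. For charge (0 | c, c − 1), row r of the second component has the residues
-- of row r + 1 of the first; hence moving the last row of μ below the last row of λ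
-- preserves the content of (λ, λ), and a core of this shape must be empty. The case
-- (0 | c − 1, c) is the mirror image, and (∅, ∅) is trivially a core for every charge.
module Submission where

open import Defs
open import Data.Integer using (ℤ; +_; ∣_∣)
open import Data.Product using (Σ; _×_; _,_)
open import Data.Sum using (_⊎_)
open import Relation.Binary.PropositionalEquality using (_≡_)

open import Data.Nat using (ℕ; zero; suc; _<_; _≥_)
open import Data.Nat.Properties using (≤-refl; 1+n≢n)
open import Data.Integer using (-[1+_]; _+_; _-_)
open import Data.Integer.Properties using (∣i∣≡0⇒i≡0)
open import Data.Integer.Tactic.RingSolver using (solve-∀)
open import Data.List using (List; []; _∷_; _++_; upTo; length)
open import Data.List.Properties using (map-cong; ++-identityʳ; ++-conicalˡ; ++-conicalʳ)
import Data.List.Properties as List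
open import Data.List.Relation.Unary.All using (All; []; _∷_)
open import Data.List.Relation.Unary.Linked using (Linked; []; [-]; _∷_)
open import Data.List.Relation.Binary.Permutation.Propositional
  using (_↭_; ↭-reflexive; module PermutationReasoning)
open import Data.List.Relation.Binary.Permutation.Propositional.Properties
  using (↭-empty-inv; ++⁺ˡ; ++-comm; shifts)
open import Data.Product using (proj₁; proj₂)
open import Data.Sum using (inj₁; inj₂)
open import Relation.Nullary using (contradiction)
open import Relation.Binary.PropositionalEquality using (_≢_; refl; sym; trans; cong; cong₂; module ≡-Reasoning)

rowResidues-suc : ∀ c a len → rowResidues c (suc a) len ≡ rowResidues (c - + 1) a len
rowResidues-suc c a len = map-cong (λ j → shift (+ suc j) (+ a) c) (upTo len)
  where
  shift : ∀ (s a c : ℤ) → (s - (+ 1 + a)) + c ≡ (s - a) + (c - + 1)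
  shift = solve-∀

++-interchange : ∀ {A : Set} (ws xs ys zs : List A) →
                 (ws ++ xs) ++ (ys ++ zs) ↭ (ws ++ ys) ++ (xs ++ zs)
++-interchange ws xs ys zs = begin
  (ws ++ xs) ++ (ys ++ zs)  ≡⟨ List.++-assoc ws xs (ys ++ zs) ⟩
  ws ++ xs ++ ys ++ zs      ↭⟨ ++⁺ˡ ws (shifts xs ys) ⟩
  ws ++ ys ++ xs ++ zs      ≡⟨ List.++-assoc ws ys (xs ++ zs) ⟨
  (ws ++ ys) ++ (xs ++ zs)  ∎
  where open PermutationReasoning

duplicateLast : ℕ → List ℕ → List ℕ
duplicateLast x []       = x ∷ x ∷ []
duplicateLast x (y ∷ ys) = x ∷ duplicateLast y ys

dropLast : ℕ → List ℕ → List ℕ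
dropLast x []       = []
dropLast x (y ∷ ys) = x ∷ dropLast y ys

length-dropLast : ∀ x ys → length (dropLast x ys) ≡ length ys
length-dropLast x []       = refl
length-dropLast x (y ∷ ys) = cong suc (length-dropLast y ys)

dropLast≢ : ∀ x ys → dropLast x ys ≢ x ∷ ys
dropLast≢ x ys eq = 1+n≢n (trans (sym (cong length eq)) (length-dropLast x ys))

All-duplicateLast : ∀ {P : ℕ → Set} {x ys} → All P (x ∷ ys) → All P (duplicateLast x ys)
All-duplicateLast {ys = []}    (px ∷ []) = px ∷ px ∷ []
All-duplicateLast {ys = _ ∷ _} (px ∷ pys) = px ∷ All-duplicateLast pys

All-dropLast : ∀ {P : ℕ → Set} {x ys} → All P (x ∷ ys) → All P (dropLast x ys)
All-dropLast {ys = []}    _          = []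
All-dropLast {ys = _ ∷ _} (px ∷ pys) = px ∷ All-dropLast pys

Linked-duplicateLast : ∀ {x ys} → Linked _≥_ (x ∷ ys) → Linked _≥_ (duplicateLast x ys)
Linked-duplicateLast {ys = []}         _          = ≤-refl ∷ [-]
Linked-duplicateLast {ys = _ ∷ []}     (r ∷ rs) = r ∷ Linked-duplicateLast rs
Linked-duplicateLast {ys = _ ∷ _ ∷ _} (r ∷ rs) = r ∷ Linked-duplicateLast rs

Linked-dropLast : ∀ {x ys} → Linked _≥_ (x ∷ ys) → Linked _≥_ (dropLast x ys)
Linked-dropLast {ys = []}         _        = []
Linked-dropLast {ys = _ ∷ []}     _        = [-]
Linked-dropLast {ys = _ ∷ _ ∷ _} (r ∷ rs) = r ∷ Linked-dropLast rs

isPartition-duplicateLast : ∀ {x ys} → IsPartition (x ∷ ys) → IsPartition (duplicateLast x ys)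
isPartition-duplicateLast (pos , dec) = All-duplicateLast pos , Linked-duplicateLast dec

isPartition-dropLast : ∀ {x ys} → IsPartition (x ∷ ys) → IsPartition (dropLast x ys)
isPartition-dropLast (pos , dec) = All-dropLast pos , Linked-dropLast dec

partResidues-moveLastRow : ∀ c a x ys →
  partResidues c a (duplicateLast x ys) ++ partResidues (c - + 1) a (dropLast x ys) ↭
  partResidues c a (x ∷ ys) ++ partResidues (c - + 1) a (x ∷ ys)
partResidues-moveLastRow c a x [] = ↭-reflexive (begin
  (rowResidues c a x ++ rowResidues c (suc a) x ++ []) ++ []
    ≡⟨ ++-identityʳ _ ⟩
  rowResidues c a x ++ rowResidues c (suc a) x ++ []
    ≡⟨ cong (λ r → rowResidues c a x ++ r ++ []) (rowResidues-suc c a x) ⟩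
  rowResidues c a x ++ rowResidues (c - + 1) a x ++ []
    ≡⟨ List.++-assoc (rowResidues c a x) [] _ ⟨
  (rowResidues c a x ++ []) ++ rowResidues (c - + 1) a x ++ []  ∎)
  where open ≡-Reasoning
partResidues-moveLastRow c a x (y ∷ ys) = begin
  (row c ++ rest c (duplicateLast y ys)) ++ (row (c - + 1) ++ rest (c - + 1) (dropLast y ys))
    ↭⟨ ++-interchange (row c) _ (row (c - + 1)) _ ⟩
  (row c ++ row (c - + 1)) ++ (rest c (duplicateLast y ys) ++ rest (c - + 1) (dropLast y ys))
    ↭⟨ ++⁺ˡ (row c ++ row (c - + 1)) (partResidues-moveLastRow c (suc a) y ys) ⟩
  (row c ++ row (c - + 1)) ++ (rest c (y ∷ ys) ++ rest (c - + 1) (y ∷ ys))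
    ↭⟨ ++-interchange (row c) _ (row (c - + 1)) _ ⟨
  (row c ++ rest c (y ∷ ys)) ++ (row (c - + 1) ++ rest (c - + 1) (y ∷ ys))  ∎
  where
  open PermutationReasoning
  row : ℤ → List ℤ
  row d = rowResidues d a x
  rest : ℤ → List ℕ → List ℤ
  rest d = partResidues d (suc a)

partResidues≡[]⇒≡[] : ∀ c a (l : List ℕ) → All (0 <_) l → partResidues c a l ≡ [] → l ≡ []
partResidues≡[]⇒≡[] c a []          _        _  = refl
partResidues≡[]⇒≡[] c a (zero ∷ _)  (() ∷ _) _
partResidues≡[]⇒≡[] c a (suc _ ∷ _) _        ()

isCore-empty : ∀ c → IsCore c ([] , [])
isCore-empty (c₁ , c₂) = (([] , []) , ([] , [])) , unique
  where
  unique : (bp : Bipartition) → IsBipartition bp → content (c₁ , c₂) bp ↭ [] → bp ≡ ([] , [])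
  unique (l , m) ((posˡ , _) , (posᵐ , _)) same =
    cong₂ _,_ (partResidues≡[]⇒≡[] c₁ 1 l posˡ (++-conicalˡ _ _ noResidues))
              (partResidues≡[]⇒≡[] c₂ 1 m posᵐ (++-conicalʳ _ _ noResidues))
    where noResidues = ↭-empty-inv same

isCore-equalCharges⇒symmetric : ∀ {c l m} → IsCore (c , c) (l , m) → l ≡ m
isCore-equalCharges⇒symmetric {c} {l} {m} ((isPartˡ , isPartᵐ) , unique) =
  cong proj₂ (unique (m , l) (isPartᵐ , isPartˡ) (++-comm (partResidues c 1 m) _))

isCore-predCharge₂-diagonal⇒empty : ∀ {c} l → IsCore (c , c - + 1) (l , l) → l ≡ []
isCore-predCharge₂-diagonal⇒empty []       _ = refl
isCore-predCharge₂-diagonal⇒empty {c} (x ∷ ys) ((isPart , _) , unique) =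
  contradiction (cong proj₂ (unique (duplicateLast x ys , dropLast x ys)
                  (isPartition-duplicateLast isPart , isPartition-dropLast isPart)
                  (partResidues-moveLastRow c 1 x ys)))
                (dropLast≢ x ys)

isCore-predCharge₁-diagonal⇒empty : ∀ {c} l → IsCore (c - + 1 , c) (l , l) → l ≡ []
isCore-predCharge₁-diagonal⇒empty []       _ = refl
isCore-predCharge₁-diagonal⇒empty {c} (x ∷ ys) ((isPart , _) , unique) =
  contradiction (cong proj₁ (unique (dropLast x ys , duplicateLast x ys)
                  (isPartition-dropLast isPart , isPartition-duplicateLast isPart)
                  moved))
                (dropLast≢ x ys)
  where
  open PermutationReasoning
  moved : content (c - + 1 , c) (dropLast x ys , duplicateLast x ys) ↭ content (c - + 1 , c) (x ∷ ys , x ∷ ys)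
  moved = begin
    partResidues (c - + 1) 1 (dropLast x ys) ++ partResidues c 1 (duplicateLast x ys)
      ↭⟨ ++-comm (partResidues (c - + 1) 1 (dropLast x ys)) _ ⟩
    partResidues c 1 (duplicateLast x ys) ++ partResidues (c - + 1) 1 (dropLast x ys)
      ↭⟨ partResidues-moveLastRow c 1 x ys ⟩
    partResidues c 1 (x ∷ ys) ++ partResidues (c - + 1) 1 (x ∷ ys)
      ↭⟨ ++-comm (partResidues c 1 (x ∷ ys)) _ ⟩
    partResidues (c - + 1) 1 (x ∷ ys) ++ partResidues c 1 (x ∷ ys)  ∎

∣i∣≡1⇒i≡±1 : ∀ i → ∣ i ∣ ≡ 1 → i ≡ + 1 ⊎ i ≡ -[1+ 0 ]
∣i∣≡1⇒i≡±1 (+ 1)      _ = inj₁ refl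
∣i∣≡1⇒i≡±1 -[1+ 0 ]   _ = inj₂ refl
∣i∣≡1⇒i≡±1 (+ 0)      ()
∣i∣≡1⇒i≡±1 (+ suc (suc _)) ()
∣i∣≡1⇒i≡±1 -[1+ suc _ ]    ()

-- (0 | 0, ±1) is (0 | c, c − 1) with c = 0, resp. (0 | c − 1, c) with c = 1.
coreOf00And0±1≡empty : ∀ {b} → b ≡ + 1 ⊎ b ≡ -[1+ 0 ] → (bp : Bipartition) →
  IsCore (+ 0 , + 0) bp → IsCore (+ 0 , b) bp → bp ≡ ([] , [])
coreOf00And0±1≡empty b≡±1 (l , m) core₀₀ core₀ᵦ with isCore-equalCharges⇒symmetric core₀₀
coreOf00And0±1≡empty (inj₁ refl) (l , l) _ core₀ᵦ | refl
  rewrite isCore-predCharge₁-diagonal⇒empty l core₀ᵦ = refl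
coreOf00And0±1≡empty (inj₂ refl) (l , l) _ core₀ᵦ | refl
  rewrite isCore-predCharge₂-diagonal⇒empty l core₀ᵦ = refl

commonCore≡empty : ∀ a b → (∣ a ∣ ≡ 0 × ∣ b ∣ ≡ 1) ⊎ (∣ a ∣ ≡ 1 × ∣ b ∣ ≡ 0) →
  (bp : Bipartition) → IsCore (+ 0 , a) bp → IsCore (+ 0 , b) bp → bp ≡ ([] , [])
commonCore≡empty a b (inj₁ (∣a∣≡0 , ∣b∣≡1)) bp coreᵃ coreᵇ with refl ← ∣i∣≡0⇒i≡0 {a} ∣a∣≡0 =
  coreOf00And0±1≡empty (∣i∣≡1⇒i≡±1 b ∣b∣≡1) bp coreᵃ coreᵇ
commonCore≡empty a b (inj₂ (∣a∣≡1 , ∣b∣≡0)) bp coreᵃ coreᵇ with refl ← ∣i∣≡0⇒i≡0 {b} ∣b∣≡0 =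
  coreOf00And0±1≡empty (∣i∣≡1⇒i≡±1 a ∣a∣≡1) bp coreᵇ coreᵃ

proposition4p1 : (a b : ℤ) →
    ((∣ a ∣ ≡ 0 × ∣ b ∣ ≡ 1) ⊎ (∣ a ∣ ≡ 1 × ∣ b ∣ ≡ 0)) →
    Σ Bipartition (λ bp → (IsCore (+ 0 , a) bp × IsCore (+ 0 , b) bp) ×
      ((bp' : Bipartition) → IsCore (+ 0 , a) bp' → IsCore (+ 0 , b) bp' → bp' ≡ bp))
proposition4p1 a b hyp =
  ([] , []) , (isCore-empty (+ 0 , a) , isCore-empty (+ 0 , b)) , commonCore≡empty a b hyp
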